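{- Let $\mathcal C$ be a class of graphs with bounded star chromatic number. Then there is an immersive transduction from $\mathcal C$ onto its monotone closure, i.e. an immersive transduction $\mathsf T$ such that every subgraph of a graph of $\mathcal C$ is produced by $\mathsf T$ from some graph of $\mathcal C$.
   Context: All graphs are finite, simple, undirected. A star coloring of $G$ is a proper vertex coloring in which any two color classes induce a star forest (equivalently, no path on four vertices is 2-colored); the star chromatic number $\chi_{\mathrm{st}}(G)$ is the minimum number of colors of a star coloring. The monotone closure of $\mathcal C$ is the class of all (not necessarily induced) subgraphs of graphs in $\mathcal C$. A $\Sigma$-expansion of $G$ ($\Sigma$ a finite set of unary symbols) is $G$ with a subset of $V(G)$ for each symbol. A simple interpretation $\mathsf I=(\nu(x),\eta(x,y))$ of first-order formulas over $\{E\}\cup\Sigma$ ($\eta$ symmetric, antireflexive) produces from $G^+$ the graph on $\nu(G^+)$ with edges $uv$ where $G^+\models\eta(u,v)$. A non-copying transduction is a pair $(\Sigma,\mathsf I)$, producing from $G$ all $\mathsf I(G^+)$. $B_r^G(U)$ is the substructure induced on vertices at distance at most $r$ from $U$. A formula $\phi(x_1,\dots,x_k)$ is $r$-local if $G\models\phi(\bar v)\iff B_r^G(\{v_1,\dots,v_k\})\models\phi(\bar v)$ for every expanded graph $G$ and tuple $\bar v$; strongly $r$-local if moreover it implies $\mathrm{dist}(x_i,x_j)\le r$ for all $i<j$. A transduction is immersive if it is non-copying and its interpretation is strongly $r$-local for some $r$. -}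

module Defs where

open import Data.Nat using (ℕ; zero; suc)
open import Data.Fin using (Fin; _<_)
open import Data.Bool using (Bool; true; false)
open import Data.Product using (Σ; ∃; _×_; _,_)
open import Data.Sum using (_⊎_)
open import Data.Empty using (⊥)
open import Data.Unit using (⊤)
open import Relation.Nullary using (¬_)
open import Relation.Binary.PropositionalEquality using (_≡_; _≢_)
open import Function.Definitions using (Injective)
open import Data.Vec.Functional using (Vector; _∷_; [])

record Graph : Set where
  field
    n      : ℕ
    adj    : Fin n → Fin n → Bool
    sym    : ∀ u v → adj u v ≡ adj v u
    irrefl : ∀ u → adj u u ≡ false

open Graph public

Edge : (G : Graph) → Fin (n G) → Fin (n G) → Set
Edge G u v = adj G u v ≡ true

GraphClass : Set₁
GraphClass = Graph → Set

TwoColoured : ∀ {k} → Fin k → Fin k → Fin k → Fin k → Set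
TwoColoured {k} a b c d =
  Σ (Fin k) λ x → Σ (Fin k) λ y →
    (a ≡ x ⊎ a ≡ y) × (b ≡ x ⊎ b ≡ y) × (c ≡ x ⊎ c ≡ y) × (d ≡ x ⊎ d ≡ y)

IsP4 : (G : Graph) → (v₁ v₂ v₃ v₄ : Fin (n G)) → Set
IsP4 G v₁ v₂ v₃ v₄ =
  (v₁ ≢ v₂) × (v₁ ≢ v₃) × (v₁ ≢ v₄) × (v₂ ≢ v₃) × (v₂ ≢ v₄) × (v₃ ≢ v₄) ×
  Edge G v₁ v₂ × Edge G v₂ v₃ × Edge G v₃ v₄

IsStarColouring : (G : Graph) {k : ℕ} → (Fin (n G) → Fin k) → Set
IsStarColouring G c =
  (∀ u v → Edge G u v → c u ≢ c v) ×
  (∀ v₁ v₂ v₃ v₄ → IsP4 G v₁ v₂ v₃ v₄ → ¬ TwoColoured (c v₁) (c v₂) (c v₃) (c v₄))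

StarColourable : Graph → ℕ → Set
StarColourable G k = Σ (Fin (n G) → Fin k) λ c → IsStarColouring G c

BoundedStarChromatic : GraphClass → Set
BoundedStarChromatic C = Σ ℕ λ k → ∀ G → C G → StarColourable G k

Subgraph : Graph → Graph → Set
Subgraph H G =
  Σ (Fin (n H) → Fin (n G)) λ f →
    Injective _≡_ _≡_ f × (∀ i j → Edge H i j → Edge G (f i) (f j))

MonotoneClosure : GraphClass → GraphClass
MonotoneClosure C H = Σ Graph λ G → C G × Subgraph H G

-- First-order formulas over {E} ∪ Σ, Σ = Fin s unary symbols,
-- with k free variables (de Bruijn style)

data Formula (s : ℕ) : ℕ → Set where
  falsum : ∀ {k} → Formula s k
  equal  : ∀ {k} → Fin k → Fin k → Formula s k
  edge   : ∀ {k} → Fin k → Fin k → Formula s k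
  label  : ∀ {k} → Fin s → Fin k → Formula s k
  neg    : ∀ {k} → Formula s k → Formula s k
  conj   : ∀ {k} → Formula s k → Formula s k → Formula s k
  disj   : ∀ {k} → Formula s k → Formula s k → Formula s k
  ex     : ∀ {k} → Formula s (suc k) → Formula s k
  all    : ∀ {k} → Formula s (suc k) → Formula s k

Expansion : ℕ → Graph → Set
Expansion s G = Fin s → Fin (n G) → Bool

-- Satisfaction in the substructure of the expanded graph (G , P)
-- induced on the vertex set D (quantifiers range over D).
-- Taking D = everything gives satisfaction in (G , P) itself.
Sat : ∀ {s k} (G : Graph) → Expansion s G → (Fin (n G) → Set) →
      Formula s k → Vector (Fin (n G)) k → Set
Sat G P D falsum       e = ⊥
Sat G P D (equal i j)  e = e i ≡ e j
Sat G P D (edge i j)   e = Edge G (e i) (e j)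
Sat G P D (label a i)  e = P a (e i) ≡ true
Sat G P D (neg φ)      e = ¬ Sat G P D φ e
Sat G P D (conj φ ψ)   e = Sat G P D φ e × Sat G P D ψ e
Sat G P D (disj φ ψ)   e = Sat G P D φ e ⊎ Sat G P D ψ e
Sat G P D (ex φ)       e = Σ (Fin (n G)) λ v → D v × Sat G P D φ (v ∷ e)
Sat G P D (all φ)      e = ∀ v → D v → Sat G P D φ (v ∷ e)

Everything : ∀ {A : Set} → A → Set
Everything _ = ⊤

_,_⊨_[_] : ∀ {s k} (G : Graph) → Expansion s G → Formula s k → Vector (Fin (n G)) k → Set
G , P ⊨ φ [ e ] = Sat G P Everything φ e

-- Reach G r u v : dist_G(u , v) ≤ r
data Reach (G : Graph) : ℕ → Fin (n G) → Fin (n G) → Set where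
  here : ∀ {r u} → Reach G r u u
  step : ∀ {r u v w} → Edge G u v → Reach G r v w → Reach G (suc r) u w

-- vertex set of B_r^G(U) for U the set of entries of the tuple e
Ball : ∀ {k} (G : Graph) → ℕ → Vector (Fin (n G)) k → Fin (n G) → Set
Ball {k} G r e v = Σ (Fin k) λ i → Reach G r (e i) v

Local : ∀ {s k} → ℕ → Formula s k → Set
Local {s} {k} r φ =
  ∀ (G : Graph) (P : Expansion s G) (e : Vector (Fin (n G)) k) →
    (G , P ⊨ φ [ e ] → Sat G P (Ball G r e) φ e) ×
    (Sat G P (Ball G r e) φ e → G , P ⊨ φ [ e ])

StronglyLocal : ∀ {s k} → ℕ → Formula s k → Set
StronglyLocal {s} {k} r φ =
  Local r φ ×
  (∀ (G : Graph) (P : Expansion s G) (e : Vector (Fin (n G)) k) →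
     G , P ⊨ φ [ e ] → ∀ (i j : Fin k) → i < j → Reach G r (e i) (e j))

-- Non-copying transductions with simple interpretations

env₁ : ∀ {A : Set} → A → Vector A 1
env₁ u = u ∷ []

env₂ : ∀ {A : Set} → A → A → Vector A 2
env₂ u v = u ∷ (v ∷ [])

record Transduction : Set where
  field
    s       : ℕ
    ν       : Formula s 1
    η       : Formula s 2
    η-sym   : ∀ (G : Graph) (P : Expansion s G) (u v : Fin (n G)) →
                G , P ⊨ η [ env₂ u v ] → G , P ⊨ η [ env₂ v u ]
    η-irrefl : ∀ (G : Graph) (P : Expansion s G) (u : Fin (n G)) →
                ¬ (G , P ⊨ η [ env₂ u u ])

open Transduction public

Produces : Transduction → Graph → Graph → Set
Produces T G H =
  Σ (Expansion (s T) G) λ P →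
  Σ (Fin (n H) → Fin (n G)) λ f →
    Injective _≡_ _≡_ f ×
    (∀ i → G , P ⊨ ν T [ env₁ (f i) ]) ×
    (∀ v → G , P ⊨ ν T [ env₁ v ] → Σ (Fin (n H)) λ i → f i ≡ v) ×
    (∀ i j → (Edge H i j → G , P ⊨ η T [ env₂ (f i) (f j) ]) ×
             (G , P ⊨ η T [ env₂ (f i) (f j) ] → Edge H i j))

Immersive : Transduction → Set
Immersive T = Σ ℕ λ r → StronglyLocal r (ν T) × StronglyLocal r (η T)

module Submission where

open import Defs
open import Data.Product using (Σ; ∃; _×_; _,_)
open import Data.Nat using (ℕ; zero; suc; _+_; s≤s)
open import Data.Fin using (Fin; zero; suc; _<_; _↑ˡ_; _↑ʳ_; splitAt)
open import Data.Fin.Properties using (any?; splitAt-↑ˡ; splitAt-↑ʳ) renaming (_≟_ to _≟ᶠ_)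
open import Data.Bool using (Bool; true)
open import Data.Bool.Properties using () renaming (_≟_ to _≟ᵇ_)
open import Data.Sum using (_⊎_; inj₁; inj₂; [_,_])
open import Relation.Nullary using (¬_; Dec; yes; no; does; contradiction)
open import Relation.Nullary.Decidable using (_×-dec_; ¬?; dec-true)
open import Relation.Binary.PropositionalEquality using (_≡_; _≢_; refl; trans; cong)
import Relation.Binary.PropositionalEquality as ≡
open import Data.Vec.Functional using (Vector)
open import Function.Definitions using (Injective)

-- A star colouring c with k colours lets us recover any subgraph H of G from G
-- plus 1 + 2k unary predicates: the colour classes, the vertices of H, and, for
-- each colour j, the vertices x whose unique neighbour y of colour j satisfies
-- xy ∈ E(H).  Every edge xy of G has an endpoint, say x, for which the other
-- endpoint is the only neighbour of x in its colour class: otherwise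
-- y' – x – y – x' with c y' = c y and c x' = c x would be a 2-coloured P4.
-- So H-edges are exactly the G-edges xy with y the marked unique
-- colour-(c y) neighbour of x, or vice versa; this is quantifier-free in the
-- expansion and hence strongly 1-local.

true⇒witness : ∀ {A : Set} (a? : Dec A) → does a? ≡ true → A
true⇒witness (yes a) _ = a

⋁ : ∀ {s k m} → (Fin k → Formula s m) → Formula s m
⋁ {k = zero}  φ = falsum
⋁ {k = suc k} φ = disj (φ zero) (⋁ (λ j → φ (suc j)))

module _ {s m : ℕ} (G : Graph) (P : Expansion s G) (D : Fin (n G) → Set) where

  ⋁-intro : ∀ {k} (φ : Fin k → Formula s m) e j → Sat G P D (φ j) e → Sat G P D (⋁ φ) e
  ⋁-intro φ e zero    sat = inj₁ sat
  ⋁-intro φ e (suc j) sat = inj₂ (⋁-intro (λ j → φ (suc j)) e j sat)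

  ⋁-elim : ∀ {k} (φ : Fin k → Formula s m) e → Sat G P D (⋁ φ) e → ∃ λ j → Sat G P D (φ j) e
  ⋁-elim {suc k} φ e (inj₁ sat) = zero , sat
  ⋁-elim {suc k} φ e (inj₂ sat) with ⋁-elim (λ j → φ (suc j)) e sat
  ... | j , sat-j = suc j , sat-j

  ⋁-map : ∀ {k} (φ ψ : Fin k → Formula s m) e e' →
          (∀ j → Sat G P D (φ j) e → Sat G P D (ψ j) e') →
          Sat G P D (⋁ φ) e → Sat G P D (⋁ ψ) e'
  ⋁-map φ ψ e e' φ⇒ψ sat with ⋁-elim φ e sat
  ... | j , sat-j = ⋁-intro ψ e' j (φ⇒ψ j sat-j)

data QuantifierFree {s : ℕ} : ∀ {k} → Formula s k → Set where
  falsum : ∀ {k} → QuantifierFree {k = k} falsum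
  equal  : ∀ {k} i j → QuantifierFree {k = k} (equal i j)
  edge   : ∀ {k} i j → QuantifierFree {k = k} (edge i j)
  label  : ∀ {k} a i → QuantifierFree {k = k} (label a i)
  conj   : ∀ {k} {φ ψ : Formula s k} → QuantifierFree φ → QuantifierFree ψ → QuantifierFree (conj φ ψ)
  disj   : ∀ {k} {φ ψ : Formula s k} → QuantifierFree φ → QuantifierFree ψ → QuantifierFree (disj φ ψ)

⋁-quantifierFree : ∀ {s k m} (φ : Fin k → Formula s m) →
                   (∀ j → QuantifierFree (φ j)) → QuantifierFree (⋁ φ)
⋁-quantifierFree {k = zero}  φ qf = falsum
⋁-quantifierFree {k = suc k} φ qf = disj (qf zero) (⋁-quantifierFree (λ j → φ (suc j)) (λ j → qf (suc j)))

Sat-quantifierFree : ∀ {s k} {φ : Formula s k} → QuantifierFree φ →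
                     ∀ G P D D' e → Sat G P D φ e → Sat G P D' φ e
Sat-quantifierFree falsum        G P D D' e ()
Sat-quantifierFree (equal i j)   G P D D' e sat = sat
Sat-quantifierFree (edge i j)    G P D D' e sat = sat
Sat-quantifierFree (label a i)   G P D D' e sat = sat
Sat-quantifierFree (conj qφ qψ)  G P D D' e (satφ , satψ) =
  Sat-quantifierFree qφ G P D D' e satφ , Sat-quantifierFree qψ G P D D' e satψ
Sat-quantifierFree (disj qφ qψ)  G P D D' e (inj₁ sat) = inj₁ (Sat-quantifierFree qφ G P D D' e sat)
Sat-quantifierFree (disj qφ qψ)  G P D D' e (inj₂ sat) = inj₂ (Sat-quantifierFree qψ G P D D' e sat)

quantifierFree⇒local : ∀ {s k} {φ : Formula s k} r → QuantifierFree φ → Local r φ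
quantifierFree⇒local r qf G P e = Sat-quantifierFree qf G P _ _ e , Sat-quantifierFree qf G P _ _ e

module _ (G : Graph) where

  Edge? : ∀ u v → Dec (Edge G u v)
  Edge? u v = adj G u v ≟ᵇ true

  Edge-sym : ∀ {u v} → Edge G u v → Edge G v u
  Edge-sym {u} {v} uv = trans (Graph.sym G v u) uv

  Edge⇒≢ : ∀ {u v} → Edge G u v → u ≢ v
  Edge⇒≢ {u} uu refl with trans (≡.sym uu) (irrefl G u)
  ... | ()

module _ {k : ℕ} (G : Graph) (c : Fin (n G) → Fin k) where

  Rival : Fin k → Fin (n G) → Fin (n G) → Set
  Rival j x y = ∃ λ y' → Edge G x y' × c y' ≡ j × y' ≢ y

  Rival? : ∀ j x y → Dec (Rival j x y)
  Rival? j x y = any? (λ y' → Edge? G x y' ×-dec (c y' ≟ᶠ j) ×-dec ¬? (y' ≟ᶠ y))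

  unrivalled⇒unique : ∀ {j x y y'} → ¬ Rival j x y → Edge G x y' → c y' ≡ j → y' ≡ y
  unrivalled⇒unique {y = y} {y'} ¬rival xy' cy' with y' ≟ᶠ y
  ... | yes y'≡y = y'≡y
  ... | no  y'≢y = contradiction (y' , xy' , cy' , y'≢y) ¬rival

  unrivalled-endpoint : IsStarColouring G c → ∀ {x y} → Edge G x y →
                        ¬ Rival (c y) x y ⊎ ¬ Rival (c x) y x
  unrivalled-endpoint (proper , star) {x} {y} xy with Rival? (c y) x y | Rival? (c x) y x
  ... | no ¬rival | _         = inj₁ ¬rival
  ... | yes _     | no ¬rival = inj₂ ¬rival
  ... | yes (y' , xy' , cy' , y'≢y) | yes (x' , yx' , cx' , x'≢x) =
    contradiction (c y , c x , inj₁ cy' , inj₂ refl , inj₁ refl , inj₂ cx') (star y' x y x' path)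
    where
    path : IsP4 G y' x y x'
    path = Edge⇒≢ G (Edge-sym G xy')
         , y'≢y
         , (λ y'≡x' → proper x y xy (trans (≡.sym cx') (trans (cong c (≡.sym y'≡x')) cy')))
         , Edge⇒≢ G xy
         , (λ x≡x' → x'≢x (≡.sym x≡x'))
         , Edge⇒≢ G yx'
         , Edge-sym G xy' , xy , yx'

module Construction (k : ℕ) where

  Labels : ℕ
  Labels = suc (k + k)

  domain : Fin Labels
  domain = zero

  colour : Fin k → Fin Labels
  colour j = suc (j ↑ˡ k)

  pointer : Fin k → Fin Labels
  pointer j = suc (k ↑ʳ j)

  expansion : (G : Graph) → (Fin (n G) → Bool) → Expansion k G → Expansion k G → Expansion Labels G
  expansion G d col ptr zero    = d
  expansion G d col ptr (suc a) = [ col , ptr ] (splitAt k a)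

  expansion-colour : ∀ G d (col ptr : Expansion k G) j v → expansion G d col ptr (colour j) v ≡ col j v
  expansion-colour G d col ptr j v rewrite splitAt-↑ˡ k j k = refl

  expansion-pointer : ∀ G d (col ptr : Expansion k G) j v → expansion G d col ptr (pointer j) v ≡ ptr j v
  expansion-pointer G d col ptr j v rewrite splitAt-↑ʳ k k j = refl

  PointsVia : Fin k → Fin 2 → Fin 2 → Formula Labels 2
  PointsVia j a b = conj (label (colour j) b) (label (pointer j) a)

  Points : Fin 2 → Fin 2 → Formula Labels 2
  Points a b = ⋁ λ j → PointsVia j a b

  x₀ y₀ : Fin 2
  x₀ = zero
  y₀ = suc zero

  νF : Formula Labels 1
  νF = label domain zero

  ηF : Formula Labels 2
  ηF = conj (edge x₀ y₀) (disj (Points x₀ y₀) (Points y₀ x₀))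

  ηF-quantifierFree : QuantifierFree ηF
  ηF-quantifierFree = conj (edge _ _) (disj (Points-qf x₀ y₀) (Points-qf y₀ x₀))
    where
    Points-qf : ∀ a b → QuantifierFree (Points a b)
    Points-qf a b = ⋁-quantifierFree _ (λ j → conj (label _ _) (label _ _))

  ηF-sym : ∀ G P u v → G , P ⊨ ηF [ env₂ u v ] → G , P ⊨ ηF [ env₂ v u ]
  ηF-sym G P u v (uv , inj₁ pts) =
    Edge-sym G uv , inj₂ (⋁-map G P Everything (λ j → PointsVia j x₀ y₀) (λ j → PointsVia j y₀ x₀)
                                (env₂ u v) (env₂ v u) (λ _ sat → sat) pts)
  ηF-sym G P u v (uv , inj₂ pts) =
    Edge-sym G uv , inj₁ (⋁-map G P Everything (λ j → PointsVia j y₀ x₀) (λ j → PointsVia j x₀ y₀)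
                                (env₂ u v) (env₂ v u) (λ _ sat → sat) pts)

  ηF-irrefl : ∀ G P u → ¬ (G , P ⊨ ηF [ env₂ u u ])
  ηF-irrefl G P u (uu , _) = Edge⇒≢ G uu refl

  T : Transduction
  T = record { s = Labels ; ν = νF ; η = ηF ; η-sym = ηF-sym ; η-irrefl = ηF-irrefl }

  immersive : Immersive T
  immersive = 1 , (quantifierFree⇒local 1 (label _ _) , νF-close)
                , (quantifierFree⇒local 1 ηF-quantifierFree , ηF-close)
    where
    νF-close : ∀ G P (e : Vector (Fin (n G)) 1) → G , P ⊨ νF [ e ] →
               ∀ i j → i < j → Reach G 1 (e i) (e j)
    νF-close G P e _ zero zero ()
    ηF-close : ∀ G P (e : Vector (Fin (n G)) 2) → G , P ⊨ ηF [ e ] →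
               ∀ i j → i < j → Reach G 1 (e i) (e j)
    ηF-close G P e (xy , _) zero (suc zero) _ = step xy here
    ηF-close G P e _ zero zero ()
    ηF-close G P e _ (suc zero) zero ()
    ηF-close G P e _ (suc zero) (suc zero) (s≤s ())

  module _ (G H : Graph) (c : Fin (n G) → Fin k) (star : IsStarColouring G c)
           (f : Fin (n H) → Fin (n G)) (f-injective : Injective _≡_ _≡_ f)
           (f-edge : ∀ i i' → Edge H i i' → Edge G (f i) (f i')) where

    InImage : Fin (n G) → Set
    InImage v = ∃ λ i → f i ≡ v

    InImage? : ∀ v → Dec (InImage v)
    InImage? v = any? (λ i → f i ≟ᶠ v)

    ImageEdge : Fin (n G) → Fin (n G) → Set
    ImageEdge x y = ∃ λ i → ∃ λ i' → f i ≡ x × f i' ≡ y × Edge H i i'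

    ImageEdge? : ∀ x y → Dec (ImageEdge x y)
    ImageEdge? x y = any? λ i → any? λ i' → (f i ≟ᶠ x) ×-dec (f i' ≟ᶠ y) ×-dec Edge? H i i'

    Pointer : Fin k → Fin (n G) → Set
    Pointer j x = ∃ λ y → c y ≡ j × ImageEdge x y × ¬ Rival G c j x y

    Pointer? : ∀ j x → Dec (Pointer j x)
    Pointer? j x = any? λ y → (c y ≟ᶠ j) ×-dec ImageEdge? x y ×-dec ¬? (Rival? G c j x y)

    inImage : Fin (n G) → Bool
    inImage v = does (InImage? v)

    hasColour : Expansion k G
    hasColour j v = does (c v ≟ᶠ j)

    isPointer : Expansion k G
    isPointer j x = does (Pointer? j x)

    P : Expansion Labels G
    P = expansion G inImage hasColour isPointer

    P-colour : ∀ j v → P (colour j) v ≡ hasColour j v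
    P-colour = expansion-colour G inImage hasColour isPointer

    P-pointer : ∀ j x → P (pointer j) x ≡ isPointer j x
    P-pointer = expansion-pointer G inImage hasColour isPointer

    colour-label⇒ : ∀ {j v} → P (colour j) v ≡ true → c v ≡ j
    colour-label⇒ {j} {v} colour-v = true⇒witness (c v ≟ᶠ j) (trans (≡.sym (P-colour j v)) colour-v)

    colour-label⇐ : ∀ {j v} → c v ≡ j → P (colour j) v ≡ true
    colour-label⇐ {j} {v} cv = trans (P-colour j v) (dec-true (c v ≟ᶠ j) cv)

    pointer-label⇒ : ∀ {j x} → P (pointer j) x ≡ true → Pointer j x
    pointer-label⇒ {j} {x} pointer-x = true⇒witness (Pointer? j x) (trans (≡.sym (P-pointer j x)) pointer-x)

    pointer-label⇐ : ∀ {j x} → Pointer j x → P (pointer j) x ≡ true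
    pointer-label⇐ {j} {x} ptr = trans (P-pointer j x) (dec-true (Pointer? j x) ptr)

    ηF-complete : ∀ i i' → Edge H i i' → G , P ⊨ ηF [ env₂ (f i) (f i') ]
    ηF-complete i i' ii' with unrivalled-endpoint G c star (f-edge i i' ii')
    ... | inj₁ ¬rival =
      f-edge i i' ii' ,
      inj₁ (⋁-intro G P Everything (λ j → PointsVia j x₀ y₀) _ (c (f i'))
              (colour-label⇐ refl , pointer-label⇐ (f i' , refl , (i , i' , refl , refl , ii') , ¬rival)))
    ... | inj₂ ¬rival =
      f-edge i i' ii' ,
      inj₂ (⋁-intro G P Everything (λ j → PointsVia j y₀ x₀) _ (c (f i))
              (colour-label⇐ refl , pointer-label⇐ (f i , refl , (i' , i , refl , refl , Edge-sym H ii') , ¬rival)))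

    PointsVia⇒Edge : ∀ {i i'} j → Edge G (f i) (f i') →
                     G , P ⊨ PointsVia j x₀ y₀ [ env₂ (f i) (f i') ] → Edge H i i'
    PointsVia⇒Edge j xy (colour-y , pointer-x) with pointer-label⇒ pointer-x
    ... | y , _ , (a , b , fa≡x , fb≡y , ab) , ¬rival
        with unrivalled⇒unique G c ¬rival xy (colour-label⇒ colour-y)
    ... | fi'≡y with f-injective fa≡x | f-injective (trans fb≡y (≡.sym fi'≡y))
    ... | refl | refl = ab

    ηF-sound : ∀ i i' → G , P ⊨ ηF [ env₂ (f i) (f i') ] → Edge H i i'
    ηF-sound i i' (xy , inj₁ pts) with ⋁-elim G P Everything (λ j → PointsVia j x₀ y₀) _ pts
    ... | j , via = PointsVia⇒Edge j xy via
    ηF-sound i i' (xy , inj₂ pts) with ⋁-elim G P Everything (λ j → PointsVia j y₀ x₀) _ pts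
    ... | j , via = Edge-sym H (PointsVia⇒Edge j (Edge-sym G xy) via)

    produces : Produces T G H
    produces = P , f , f-injective
             , (λ i → dec-true (InImage? (f i)) (i , refl))
             , (λ v → true⇒witness (InImage? v))
             , (λ i i' → ηF-complete i i' , ηF-sound i i')

lemmaA1 : (C : GraphClass) → BoundedStarChromatic C →
    Σ Transduction λ T → Immersive T ×
      (∀ H → MonotoneClosure C H → Σ Graph λ G → C G × Produces T G H)
lemmaA1 C (k , colourable) = T , immersive , produced
  where
  open Construction k
  produced : ∀ H → MonotoneClosure C H → Σ Graph λ G → C G × Produces T G H
  produced H (G , G∈C , f , f-injective , f-edge) with colourable G G∈C
  ... | c , star = G , G∈C , produces G H c star f f-injective f-edge
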